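{- Let $G_1,G_2$ be two $(k-1)$-uniform hypergraphs on vertex set $\{0,1,\ldots,N-1\}$, let $\mathcal{T}$ be a family of types of binary structure of size $k$, and let $G$ be the stepping up of $(G_1,G_2,\mathcal{T})$. Then \[ \alpha(G)\le f\bigl(\alpha(G_1)+2,\ \alpha(G_2)+2,\ \mathcal{T}\bigr). \]
   Context: $\alpha(\cdot)$ denotes the independence number (largest vertex set containing no edge). Top splitting level: for a set $S$ of at least two nonnegative integers, $\ell(S)$ is the largest nonnegative integer $\ell$ such that $\{\lfloor 2^{ -\ell}s\rfloor : s\in S\}$ has at least two elements; the left subset $S_{\mathrm{Left}}$ is the set of $s\in S$ with $\lfloor 2^{ -\ell(S)}s\rfloor$ even, and the right subset $S_{\mathrm{Right}}$ is the set of $s\in S$ with $\lfloor 2^{ -\ell(S)}s\rfloor$ odd (both are nonempty). Binary structure: $b(S)$ is the weighted rooted ordered binary tree defined recursively: if $|S|=1$ it is a single root of weight $1$; if $|S|>1$ the root has weight $|S|$, its left subtree is $b(S_{\mathrm{Left}})$ and its right subtree is $b(S_{\mathrm{Right}})$. $b(S)$ is increasing if the right subtree of every internal node is a single vertex, decreasing if the left subtree of every internal node is a single vertex, and monotone if increasing or decreasing. For $S$ with monotone binary structure, $L(S)$ is defined recursively: $L(S)=\emptyset$ if $|S|=1$; otherwise $L(S)=L(S')\cup\{\ell(S)\}$ where $S'=S_{\mathrm{Left}}$ if $b(S)$ is increasing and $S'=S_{\mathrm{Right}}$ if $b(S)$ is decreasing. A type of binary structure $T$ is a weighted rooted ordered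 binary tree whose leaves have positive integer weights and each internal vertex has weight equal to the sum of its children's weights; its size is the root weight. A set $S$ is of type $T$ if $T$ can be obtained from $b(S)$ by iteratively removing leaves (keeping the weights of the remaining vertices). $T$ is monotone if some set $S$ of type $T$ has $b(S)$ monotone. Stepping up: for $(k-1)$-graphs $G_1,G_2$ on $\{0,\ldots,N-1\}$, the left stepping-up of $G_1$ is the $k$-graph on $\{0,\ldots,2^N-1\}$ whose edges are the $k$-sets $e$ with $b(e)$ increasing and $L(e)\in E(G_1)$; the right stepping-up of $G_2$ is the $k$-graph on $\{0,\ldots,2^N-1\}$ whose edges are the $k$-sets $e$ with $b(e)$ decreasing and $\{N-1-\ell:\ell\in L(e)\}\in E(G_2)$. For a family $\mathcal{T}$ of types of size $k$, $G_{\mathcal T}$ is the $k$-graph on $\{0,\ldots,2^N-1\}$ whose edges are the $k$-sets of type $T$ for some $T\in\mathcal{T}$. The stepping up of $(G_1,G_2,\mathcal T)$ is the edge union of the left stepping-up of $G_1$, the right stepping-up of $G_2$, and $G_{\mathcal T}$. For positive integers $n_1,n_2$ and a family $\mathcal T$ of types, $f(n_1,n_2,\mathcal T)$ is the maximum size of a set $S$ of nonnegative integers containing no $n_1$-subset with increasing binary structure, no $n_2$-subset with decreasing binary structure, and no subset of type $T$ for any $T\in\mathcal T$. -}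

module Defs where

open import Data.Nat using (ℕ; zero; suc; _+_; _∸_; _^_; _≤_; _<_; _/_; _%_; _≟_)
open import Data.Nat.Properties using (m^n≢0)
open import Data.Bool using (Bool; true; false; if_then_else_; not)
open import Data.List using (List; []; _∷_; _++_; length; map; filter)
open import Data.Bool.ListAction using (any)
open import Data.Nat.ListAction using (sum)
open import Data.List.Relation.Unary.All using (All)
open import Data.List.Relation.Unary.Linked using (Linked)
open import Data.List.Relation.Binary.Sublist.Propositional using (_⊆_)
open import Data.List.Membership.Propositional using (_∈_)
open import Data.Product using (Σ; ∃; _×_)
open import Data.Sum using (_⊎_)
open import Relation.Nullary using (¬_; does)
open import Relation.Binary.PropositionalEquality using (_≡_)

-- Finite sets of nonnegative integers are represented by strictly increasing
-- lists (Linked _<_); subsets are sublists.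
IsSet : List ℕ → Set
IsSet S = Linked _<_ S

SameSet : List ℕ → List ℕ → Set
SameSet A B = ∀ x → (x ∈ A → x ∈ B) × (x ∈ B → x ∈ A)

shiftDown : ℕ → ℕ → ℕ
shiftDown ℓ s = _/_ s (2 ^ ℓ) {{m^n≢0 2 ℓ}}

floors : ℕ → List ℕ → List ℕ
floors ℓ S = map (shiftDown ℓ) S

atLeastTwo : List ℕ → Bool
atLeastTwo [] = false
atLeastTwo (x ∷ xs) = any (λ y → not (does (y ≟ x))) xs

-- largest n < B with P n (0 if there is none)
lastBelow : (ℕ → Bool) → ℕ → ℕ
lastBelow P zero = 0
lastBelow P (suc n) = if P n then n else lastBelow P n

-- top splitting level ℓ(S): the largest ℓ such that {⌊2^{-ℓ}s⌋ : s ∈ S} has at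
-- least two elements.  For ℓ > sum S every floor is 0, so the search bound
-- suc (sum S) is large enough.
level : List ℕ → ℕ
level S = lastBelow (λ ℓ → atLeastTwo (floors ℓ S)) (suc (sum S))

isEven : ℕ → Bool
isEven n = does (n % 2 ≟ 0)

leftPart : List ℕ → List ℕ
leftPart S = filter (λ s → isEven (shiftDown (level S) s) Data.Bool.≟ true) S

rightPart : List ℕ → List ℕ
rightPart S = filter (λ s → isEven (shiftDown (level S) s) Data.Bool.≟ false) S

data Tree : Set where
  leaf : ℕ → Tree
  node : ℕ → Tree → Tree → Tree

weight : Tree → ℕ
weight (leaf w) = w
weight (node w l r) = w

-- binary structure, with fuel (fuel = |S| always suffices, as each split
-- strictly decreases the size); b [] is junk and never used.
bFuel : ℕ → List ℕ → Tree
bFuel _ [] = leaf 0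
bFuel _ (s ∷ []) = leaf 1
bFuel zero S = leaf (length S)
bFuel (suc f) S = node (length S) (bFuel f (leftPart S)) (bFuel f (rightPart S))

b : List ℕ → Tree
b S = bFuel (length S) S

data Increasing : Tree → Set where
  leaf : ∀ {w} → Increasing (leaf w)
  node : ∀ {w w' l} → Increasing l → Increasing (node w l (leaf w'))

data Decreasing : Tree → Set where
  leaf : ∀ {w} → Decreasing (leaf w)
  node : ∀ {w w' r} → Decreasing r → Decreasing (node w (leaf w') r)

LIncFuel : ℕ → List ℕ → List ℕ
LIncFuel _ [] = []
LIncFuel _ (s ∷ []) = []
LIncFuel zero S = []
LIncFuel (suc f) S = LIncFuel f (leftPart S) ++ (level S ∷ [])

LInc : List ℕ → List ℕ
LInc S = LIncFuel (length S) S

LDecFuel : ℕ → List ℕ → List ℕ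
LDecFuel _ [] = []
LDecFuel _ (s ∷ []) = []
LDecFuel zero S = []
LDecFuel (suc f) S = LDecFuel f (rightPart S) ++ (level S ∷ [])

LDec : List ℕ → List ℕ
LDec S = LDecFuel (length S) S

data IsType : Tree → Set where
  leaf : ∀ {w} → 1 ≤ w → IsType (leaf w)
  node : ∀ {l r} → IsType l → IsType r → IsType (node (weight l + weight r) l r)

-- Prune t T : T is obtained from t by iteratively removing leaves
-- (weights of remaining vertices kept)
data Prune : Tree → Tree → Set where
  stop : ∀ {t} → Prune t (leaf (weight t))
  node : ∀ {w l r l' r'} → Prune l l' → Prune r r' → Prune (node w l r) (node w l' r')

OfType : List ℕ → Tree → Set
OfType S T = Prune (b S) T

-- hypergraphs: an r-graph on {0,…,M-1} is a predicate on sets (edges)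

Uniform : ℕ → ℕ → (List ℕ → Set) → Set
Uniform M r G = ∀ e → G e → IsSet e × length e ≡ r × All (_< M) e

Independent : ℕ → (List ℕ → Set) → List ℕ → Set
Independent M G I = IsSet I × All (_< M) I × (∀ e → e ⊆ I → ¬ G e)

IsMax : (List ℕ → Set) → ℕ → Set
IsMax P m = (∃ λ S → P S × length S ≡ m) × (∀ S → P S → length S ≤ m)

SteppingUp : ℕ → ℕ → (List ℕ → Set) → (List ℕ → Set) → (Tree → Set) → List ℕ → Set
SteppingUp N k G1 G2 𝒯 e =
  IsSet e × All (_< 2 ^ N) e × length e ≡ k ×
  ( (Increasing (b e) × ∃ λ D → G1 D × SameSet D (LInc e))
  ⊎ (Decreasing (b e) × ∃ λ D → G2 D × SameSet D (map (λ ℓ → N ∸ 1 ∸ ℓ) (LDec e)))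
  ⊎ (∃ λ T → 𝒯 T × OfType e T))

Avoids : ℕ → ℕ → (Tree → Set) → List ℕ → Set
Avoids n1 n2 𝒯 S =
  IsSet S
  × (∀ S' → S' ⊆ S → length S' ≡ n1 → ¬ Increasing (b S'))
  × (∀ S' → S' ⊆ S → length S' ≡ n2 → ¬ Decreasing (b S'))
  × (∀ S' → S' ⊆ S → ∀ T → 𝒯 T → ¬ OfType S' T)

{-# OPTIONS --safe #-}
module Submission where

-- Let I be a maximum independent set of the stepping-up G.  A subset of I of a type in
-- 𝒯 would be an edge of G, so there is none.  Let S ⊆ I have increasing binary
-- structure: along the chain of top splits of S the right part is always a single point,
-- and L(S) lists the |S| - 1 splitting levels, all below N.  Each D ⊆ L(S) equals L(e)
-- for some e ⊆ S with increasing structure and |e| = |D| + 1: keep the split-off point of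
-- every split whose level lies in D, and the least point of S.  As e meets both sides of
-- each of these splits, it splits at the same levels.  For |D| = k - 1, e is a k-subset
-- of I and hence not an edge, so D is not an edge of G1; thus L(S) is independent in G1
-- and |S| ≤ α(G1) + 1.  Decreasing subsets are handled alike, with the mirrored levels
-- N - 1 - ℓ and G2.

open import Defs
open import Data.Nat using (ℕ; zero; suc; _+_; _*_; _∸_; _^_; _≤_; _<_; _/_; _%_; _≟_;
  z≤n; s≤s; s≤s⁻¹; NonZero; _≤′_; ≤′-refl; ≤′-step)
open import Data.Nat.Properties
open import Data.Nat.DivMod
open import Data.Nat.ListAction using (sum)
open import Data.Bool using (Bool; true; false; T; not)
import Data.Bool as Bool
open import Data.Bool.Properties using (not-¬)
open import Data.List using (List; []; _∷_; _++_; length; map; filter; reverse)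
import Data.List.Properties as Listₚ
open import Data.List.Relation.Unary.All as All using (All; []; _∷_)
import Data.List.Relation.Unary.All.Properties as Allₚ
open import Data.List.Relation.Unary.Any as Any using (Any; here; there)
import Data.List.Relation.Unary.Any.Properties as Anyₚ
open import Data.List.Relation.Unary.AllPairs using (AllPairs; []; _∷_)
import Data.List.Relation.Unary.AllPairs.Properties as AllPairsₚ
open import Data.List.Relation.Unary.Linked as Linked using ([]; [-]; _∷_)
open import Data.List.Relation.Unary.Linked.Properties using (Linked⇒All; Linked⇒AllPairs; AllPairs⇒Linked)
open import Data.List.Membership.Propositional using (_∈_; find; lose)
open import Data.List.Membership.Propositional.Properties using (∈-filter⁺)
open import Data.List.Relation.Binary.Sublist.Propositional using (_⊆_; []; _∷_; _∷ʳ_; ⊆-refl; ⊆-trans; from∈)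
import Data.List.Relation.Binary.Sublist.Propositional.Properties as Sublistₚ
open import Data.List.Relation.Binary.Permutation.Propositional using (_↭_; ↭-reflexive; ↭-sym; ↭-trans)
open import Data.List.Relation.Binary.Permutation.Propositional.Properties using (∈-resp-↭; ↭-reverse)
open import Data.Product using (∃; _×_; _,_; proj₁; proj₂)
open import Data.Sum using (_⊎_; inj₁; inj₂)
open import Data.Empty using (⊥; ⊥-elim)
open import Function using (_∘_)
open import Relation.Nullary using (¬_; Dec; yes; no; does)
open import Relation.Nullary.Decidable using (dec-true; dec-false)
open import Relation.Binary.PropositionalEquality

length-∷ʳ : ∀ (xs : List ℕ) y → length (xs ++ y ∷ []) ≡ suc (length xs)
length-∷ʳ xs y = trans (Listₚ.length-++ xs) (+-comm (length xs) 1)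

∈⇒≤sum : ∀ {s S} → s ∈ S → s ≤ sum S
∈⇒≤sum {S = x ∷ xs} (here refl) = m≤m+n x (sum xs)
∈⇒≤sum {S = x ∷ xs} (there s∈) = ≤-trans (∈⇒≤sum s∈) (m≤n+m (sum xs) x)

All-reverse : ∀ {P : ℕ → Set} {xs} → All P xs → All P (reverse xs)
All-reverse Pxs = All.tabulate (All.lookup Pxs ∘ Anyₚ.reverse⁻)

AllPairs-⊆ : ∀ {R : ℕ → ℕ → Set} {e S} → e ⊆ S → AllPairs R S → AllPairs R e
AllPairs-⊆ [] [] = []
AllPairs-⊆ (_ ∷ʳ e⊆S) (_ ∷ ps) = AllPairs-⊆ e⊆S ps
AllPairs-⊆ (refl ∷ e⊆S) (p ∷ ps) = Sublistₚ.All-resp-⊆ e⊆S p ∷ AllPairs-⊆ e⊆S ps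

IsSet-⊆ : ∀ {e S} → e ⊆ S → IsSet S → IsSet e
IsSet-⊆ e⊆S = AllPairs⇒Linked ∘ AllPairs-⊆ e⊆S ∘ Linked⇒AllPairs <-trans

IsSet-∷ʳ : ∀ {xs y} → IsSet xs → All (_< y) xs → IsSet (xs ++ y ∷ [])
IsSet-∷ʳ xs-set xs<y = AllPairs⇒Linked
  (AllPairsₚ.++⁺ (Linked⇒AllPairs <-trans xs-set) ([] ∷ []) (All.map (_∷ []) xs<y))

head<tail : ∀ {x xs} → IsSet (x ∷ xs) → All (x <_) xs
head<tail [-] = []
head<tail (x<y ∷ ys) = Linked⇒All <-trans x<y ys

⊆-∷ʳ⁻ : ∀ {D xs : List ℕ} {y} → D ⊆ xs ++ y ∷ [] →
         D ⊆ xs ⊎ ∃ λ D′ → D ≡ D′ ++ y ∷ [] × D′ ⊆ xs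
⊆-∷ʳ⁻ {xs = []} (_ ∷ʳ []) = inj₁ []
⊆-∷ʳ⁻ {xs = []} (refl ∷ []) = inj₂ ([] , refl , [])
⊆-∷ʳ⁻ {xs = x ∷ xs} (.x ∷ʳ D⊆) with ⊆-∷ʳ⁻ D⊆
... | inj₁ D⊆xs = inj₁ (x ∷ʳ D⊆xs)
... | inj₂ (D′ , D≡ , D′⊆xs) = inj₂ (D′ , D≡ , x ∷ʳ D′⊆xs)
⊆-∷ʳ⁻ {xs = x ∷ xs} (refl ∷ D⊆) with ⊆-∷ʳ⁻ D⊆
... | inj₁ D⊆xs = inj₁ (refl ∷ D⊆xs)
... | inj₂ (D′ , D≡ , D′⊆xs) = inj₂ (x ∷ D′ , cong (x ∷_) D≡ , refl ∷ D′⊆xs)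

⊆-map⁻ : ∀ (f : ℕ → ℕ) L {ys} → ys ⊆ map f L → ∃ λ xs → xs ⊆ L × map f xs ≡ ys
⊆-map⁻ f [] [] = [] , [] , refl
⊆-map⁻ f (x ∷ L) (_ ∷ʳ ys⊆) with ⊆-map⁻ f L ys⊆
... | xs , xs⊆L , xs≡ = xs , x ∷ʳ xs⊆L , xs≡
⊆-map⁻ f (x ∷ L) (refl ∷ ys⊆) with ⊆-map⁻ f L ys⊆
... | xs , xs⊆L , xs≡ = x ∷ xs , refl ∷ xs⊆L , cong (f x ∷_) xs≡

↭⇒SameSet : ∀ {A B : List ℕ} → A ↭ B → SameSet A B
↭⇒SameSet A↭B x = ∈-resp-↭ A↭B , ∈-resp-↭ (↭-sym A↭B)

true-or-false : ∀ b → b ≡ true ⊎ b ≡ false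
true-or-false true = inj₁ refl
true-or-false false = inj₂ refl

≢⇒distinct : ∀ {a b} → a ≢ b → T (not (does (a ≟ b)))
≢⇒distinct {a} {b} a≢b = subst (T ∘ not) (sym (dec-false (a ≟ b) a≢b)) _

distinct⇒≢ : ∀ {a b} → T (not (does (a ≟ b))) → a ≢ b
distinct⇒≢ {a} {b} t a≡b = subst (T ∘ not) (dec-true (a ≟ b) a≡b) t

-- Dyadic floors and the top splitting level

shiftDown-zero : ∀ s → shiftDown 0 s ≡ s
shiftDown-zero = n/1≡n

shiftDown-suc : ∀ ℓ s → shiftDown (suc ℓ) s ≡ shiftDown ℓ s / 2
shiftDown-suc ℓ s = trans (/-congʳ {{m^n≢0 2 (suc ℓ)}} {{2^ℓ*2≢0}} (*-comm 2 (2 ^ ℓ)))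
                          (sym (m/n/o≡m/[n*o] s (2 ^ ℓ) 2 {{m^n≢0 2 ℓ}} {{_}} {{2^ℓ*2≢0}}))
  where
  2^ℓ*2≢0 : NonZero (2 ^ ℓ * 2)
  2^ℓ*2≢0 = m*n≢0 (2 ^ ℓ) 2 {{m^n≢0 2 ℓ}}

shiftDown-mono : ∀ ℓ {x y} → x ≤ y → shiftDown ℓ x ≤ shiftDown ℓ y
shiftDown-mono ℓ = /-monoˡ-≤ (2 ^ ℓ) {{m^n≢0 2 ℓ}}

shiftDown-small : ∀ ℓ {s} → s < 2 ^ ℓ → shiftDown ℓ s ≡ 0
shiftDown-small ℓ = m<n⇒m/n≡0 {{m^n≢0 2 ℓ}}

n<2^n : ∀ n → n < 2 ^ n
n<2^n zero = s≤s z≤n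
n<2^n (suc n) = +-mono-≤ (m^n>0 2 n) (≤-trans (n<2^n n) (m≤m+n (2 ^ n) 0))

isEven-true : ∀ n → isEven n ≡ true → n ≡ n / 2 * 2
isEven-true n even with n % 2 | m%n<n n 2 | m≡m%n+[m/n]*n n 2
... | 0 | _ | n≡ = n≡
isEven-true n () | 1 | _ | _
... | suc (suc _) | s≤s (s≤s ()) | _

isEven-false : ∀ n → isEven n ≡ false → n ≡ suc (n / 2 * 2)
isEven-false n odd with n % 2 | m%n<n n 2 | m≡m%n+[m/n]*n n 2
isEven-false n () | 0 | _ | _
... | 1 | _ | n≡ = n≡
... | suc (suc _) | s≤s (s≤s ()) | _

Block : ℕ → ℕ → List ℕ → Set
Block ℓ d S = All (λ s → shiftDown ℓ s ≡ d) S

data Split (ℓ : ℕ) (S : List ℕ) : Set where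
  split : ∀ {x y} → x ∈ S → y ∈ S → shiftDown ℓ x ≢ shiftDown ℓ y → Split ℓ S

block-suc : ∀ {ℓ d S} → Block ℓ d S → Block (suc ℓ) (d / 2) S
block-suc {ℓ} = All.map (λ {s} eq → trans (shiftDown-suc ℓ s) (cong (_/ 2) eq))

block-mono : ∀ {ℓ m d S} → ℓ ≤′ m → Block ℓ d S → ∃ λ d′ → Block m d′ S
block-mono ≤′-refl blk = _ , blk
block-mono {ℓ} (≤′-step {m} ℓ≤m) blk = _ , block-suc {m} (proj₂ (block-mono {ℓ} ℓ≤m blk))

split⇒¬block : ∀ {ℓ d S} → Split ℓ S → ¬ Block ℓ d S
split⇒¬block (split x∈ y∈ x≉y) blk = x≉y (trans (All.lookup blk x∈) (sym (All.lookup blk y∈)))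

split-<-block : ∀ {ℓ m d S} → Split ℓ S → Block m d S → ℓ < m
split-<-block {m = m} sp blk = ≰⇒> λ m≤ℓ → split⇒¬block sp (proj₂ (block-mono {m} (≤⇒≤′ m≤ℓ) blk))

set-split : ∀ {S} → IsSet S → 2 ≤ length S → Split 0 S
set-split {_ ∷ []} _ (s≤s ())
set-split {x ∷ y ∷ _} (x<y ∷ _) _ = split (here refl) (there (here refl)) λ eq →
  <⇒≢ x<y (trans (sym (shiftDown-zero x)) (trans eq (shiftDown-zero y)))

split-or-block : ∀ ℓ x xs → Split ℓ (x ∷ xs) ⊎ Block ℓ (shiftDown ℓ x) (x ∷ xs)
split-or-block ℓ x xs with All.all? (λ y → shiftDown ℓ y ≟ shiftDown ℓ x) xs
... | yes same = inj₂ (refl ∷ same)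
... | no ¬same with find (Allₚ.¬All⇒Any¬ (λ y → shiftDown ℓ y ≟ shiftDown ℓ x) xs ¬same)
...   | y , y∈ , y≉x = inj₁ (split (there y∈) (here refl) y≉x)

differs-from-head : ∀ {ℓ x xs w} → w ∈ x ∷ xs → shiftDown ℓ w ≢ shiftDown ℓ x →
                    Any (λ y → shiftDown ℓ y ≢ shiftDown ℓ x) xs
differs-from-head (here refl) w≉x = ⊥-elim (w≉x refl)
differs-from-head (there w∈) w≉x = lose w∈ w≉x

split⇒head-differs : ∀ {ℓ x xs} → Split ℓ (x ∷ xs) → Any (λ y → shiftDown ℓ y ≢ shiftDown ℓ x) xs
split⇒head-differs {ℓ} {x} (split {y} y∈ z∈ y≉z) with shiftDown ℓ y ≟ shiftDown ℓ x
... | yes y≈x = differs-from-head {ℓ} z∈ (λ z≈x → y≉z (trans y≈x (sym z≈x)))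
... | no y≉x = differs-from-head {ℓ} y∈ y≉x

atLeastTwo-floors⁺ : ∀ {ℓ S} → Split ℓ S → T (atLeastTwo (floors ℓ S))
atLeastTwo-floors⁺ {S = []} (split () _ _)
atLeastTwo-floors⁺ {S = x ∷ xs} sp =
  Anyₚ.any⁺ _ (Anyₚ.map⁺ (Any.map ≢⇒distinct (split⇒head-differs sp)))

atLeastTwo-floors⁻ : ∀ {ℓ S} → T (atLeastTwo (floors ℓ S)) → Split ℓ S
atLeastTwo-floors⁻ {ℓ} {x ∷ xs} t with find (Anyₚ.map⁻ (Anyₚ.any⁻ _ (map (shiftDown ℓ) xs) t))
... | y , y∈ , y≉x = split (there y∈) (here refl) (distinct⇒≢ y≉x)

lastBelow-true : ∀ (Q : ℕ → Bool) B {ℓ} → ℓ < B → T (Q ℓ) → T (Q (lastBelow Q B))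
lastBelow-true Q (suc n) ℓ<B qℓ with Q n in qn
... | true = subst T (sym qn) _
... | false with m≤n⇒m<n∨m≡n (s≤s⁻¹ ℓ<B)
...   | inj₁ ℓ<n = lastBelow-true Q n ℓ<n qℓ
...   | inj₂ refl = ⊥-elim (subst T qn qℓ)

lastBelow-maximal : ∀ (Q : ℕ → Bool) B {ℓ} → ℓ < B → T (Q ℓ) → ℓ ≤ lastBelow Q B
lastBelow-maximal Q (suc n) ℓ<B qℓ with Q n in qn
... | true = s≤s⁻¹ ℓ<B
... | false with m≤n⇒m<n∨m≡n (s≤s⁻¹ ℓ<B)
...   | inj₁ ℓ<n = lastBelow-maximal Q n ℓ<n qℓ
...   | inj₂ refl = ⊥-elim (subst T qn qℓ)

split⇒≤sum : ∀ {ℓ S} → Split ℓ S → ℓ ≤ sum S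
split⇒≤sum {ℓ} sp = ≮⇒≥ λ sum<ℓ → split⇒¬block {d = 0} sp
  (All.tabulate λ s∈ → shiftDown-small ℓ
    (<-≤-trans (s≤s (∈⇒≤sum s∈)) (≤-trans sum<ℓ (<⇒≤ (n<2^n ℓ)))))

level-split : ∀ {ℓ S} → Split ℓ S → Split (level S) S
level-split {S = S} sp = atLeastTwo-floors⁻
  (lastBelow-true (λ ℓ → atLeastTwo (floors ℓ S)) _ (s≤s (split⇒≤sum sp)) (atLeastTwo-floors⁺ sp))

level-maximal : ∀ {ℓ S} → Split ℓ S → ℓ ≤ level S
level-maximal {S = S} sp =
  lastBelow-maximal (λ ℓ → atLeastTwo (floors ℓ S)) _ (s≤s (split⇒≤sum sp)) (atLeastTwo-floors⁺ sp)

level-<-block : ∀ {ℓ m d S} → Split ℓ S → Block m d S → level S < m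
level-<-block sp = split-<-block (level-split sp)

level-unique : ∀ {ℓ d S} → Split ℓ S → Block (suc ℓ) d S → level S ≡ ℓ
level-unique sp blk = ≤-antisym (s≤s⁻¹ (level-<-block sp blk)) (level-maximal sp)

level-block : ∀ {ℓ S} → Split ℓ S → ∃ λ d → Block (suc (level S)) d S
level-block {S = []} (split () _ _)
level-block {S = x ∷ xs} sp with split-or-block (suc (level (x ∷ xs))) x xs
... | inj₁ sp′ = ⊥-elim (<-irrefl refl (level-maximal sp′))
... | inj₂ blk = _ , blk

-- The top split of a set

evenAt? : ∀ ℓ s → Dec (isEven (shiftDown ℓ s) ≡ true)
evenAt? ℓ s = isEven (shiftDown ℓ s) Bool.≟ true

oddAt? : ∀ ℓ s → Dec (isEven (shiftDown ℓ s) ≡ false)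
oddAt? ℓ s = isEven (shiftDown ℓ s) Bool.≟ false

-- All of S has the same floor c at level ℓ(S) + 1, so at level ℓ(S) the left part sits
-- at floor 2c and the right part at floor 2c + 1.
module TopSplit {S : List ℕ} (S-set : IsSet S) (S-two : 2 ≤ length S) where

  ℓ : ℕ
  ℓ = level S

  c : ℕ
  c = proj₁ (level-block (set-split S-set S-two))

  S-block : Block (suc ℓ) c S
  S-block = proj₂ (level-block (set-split S-set S-two))

  private
    floor-even : ∀ {s} → s ∈ S → isEven (shiftDown ℓ s) ≡ true → shiftDown ℓ s ≡ c * 2
    floor-even {s} s∈ even = trans (isEven-true _ even)
      (cong (_* 2) (trans (sym (shiftDown-suc ℓ s)) (All.lookup S-block s∈)))

    floor-odd : ∀ {s} → s ∈ S → isEven (shiftDown ℓ s) ≡ false → shiftDown ℓ s ≡ suc (c * 2)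
    floor-odd {s} s∈ odd = trans (isEven-false _ odd)
      (cong (λ h → suc (h * 2)) (trans (sym (shiftDown-suc ℓ s)) (All.lookup S-block s∈)))

  leftPart-⊆ : leftPart S ⊆ S
  leftPart-⊆ = Sublistₚ.filter-⊆ (evenAt? ℓ) S

  rightPart-⊆ : rightPart S ⊆ S
  rightPart-⊆ = Sublistₚ.filter-⊆ (oddAt? ℓ) S

  leftPart-even : All (λ s → isEven (shiftDown ℓ s) ≡ true) (leftPart S)
  leftPart-even = Allₚ.all-filter (evenAt? ℓ) S

  rightPart-odd : All (λ s → isEven (shiftDown ℓ s) ≡ false) (rightPart S)
  rightPart-odd = Allₚ.all-filter (oddAt? ℓ) S

  leftPart-block : Block ℓ (c * 2) (leftPart S)
  leftPart-block = All.tabulate λ s∈ →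
    floor-even (Sublistₚ.Any-resp-⊆ leftPart-⊆ s∈) (All.lookup leftPart-even s∈)

  rightPart-block : Block ℓ (suc (c * 2)) (rightPart S)
  rightPart-block = All.tabulate λ s∈ →
    floor-odd (Sublistₚ.Any-resp-⊆ rightPart-⊆ s∈) (All.lookup rightPart-odd s∈)

  left≢right : ∀ {x y} → x ∈ leftPart S → y ∈ rightPart S → shiftDown ℓ x ≢ shiftDown ℓ y
  left≢right x∈ y∈ eq = <⇒≢ (n<1+n (c * 2))
    (trans (sym (All.lookup leftPart-block x∈)) (trans eq (All.lookup rightPart-block y∈)))

  private
    side : ∀ {s} → s ∈ S → s ∈ leftPart S ⊎ s ∈ rightPart S
    side {s} s∈ with isEven (shiftDown ℓ s) in eq
    ... | true = inj₁ (∈-filter⁺ (evenAt? ℓ) s∈ eq)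
    ... | false = inj₂ (∈-filter⁺ (oddAt? ℓ) s∈ eq)

  parts-nonempty : (∃ λ x → x ∈ leftPart S) × (∃ λ y → y ∈ rightPart S)
  parts-nonempty with level-split (set-split S-set S-two)
  ... | split {x} {y} x∈ y∈ x≉y with side x∈ | side y∈
  ...   | inj₁ xL | inj₂ yR = (x , xL) , (y , yR)
  ...   | inj₂ xR | inj₁ yL = (y , yL) , (x , xR)
  ...   | inj₁ xL | inj₁ yL = ⊥-elim (split⇒¬block (split {ℓ} xL yL x≉y) leftPart-block)
  ...   | inj₂ xR | inj₂ yR = ⊥-elim (split⇒¬block (split {ℓ} xR yR x≉y) rightPart-block)

  private
    odd-upward : ∀ {x y} → x ∈ S → y ∈ S → x < y →
                 isEven (shiftDown ℓ x) ≡ false → isEven (shiftDown ℓ y) ≡ false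
    odd-upward {x} {y} x∈ y∈ x<y odd with isEven (shiftDown ℓ y) in eq
    ... | false = refl
    ... | true = ⊥-elim (1+n≰n (subst₂ _≤_ (floor-odd x∈ odd) (floor-even y∈ eq) (shiftDown-mono ℓ (<⇒≤ x<y))))

    filter-parts : ∀ {T} → IsSet T → All (_∈ S) T → filter (evenAt? ℓ) T ++ filter (oddAt? ℓ) T ≡ T
    filter-parts {[]} _ _ = refl
    filter-parts {t ∷ T} T-set (t∈ ∷ T∈) with true-or-false (isEven (shiftDown ℓ t))
    ... | inj₁ even = begin
      filter (evenAt? ℓ) (t ∷ T) ++ filter (oddAt? ℓ) (t ∷ T)
        ≡⟨ cong₂ _++_ (Listₚ.filter-accept (evenAt? ℓ) even) (Listₚ.filter-reject (oddAt? ℓ) (not-¬ even)) ⟩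
      t ∷ (filter (evenAt? ℓ) T ++ filter (oddAt? ℓ) T)
        ≡⟨ cong (t ∷_) (filter-parts (Linked.tail T-set) T∈) ⟩
      t ∷ T ∎
      where open ≡-Reasoning
    ... | inj₂ odd = begin
      filter (evenAt? ℓ) (t ∷ T) ++ filter (oddAt? ℓ) (t ∷ T)
        ≡⟨ cong₂ _++_ (Listₚ.filter-reject (evenAt? ℓ) (not-¬ odd)) (Listₚ.filter-accept (oddAt? ℓ) odd) ⟩
      filter (evenAt? ℓ) T ++ t ∷ filter (oddAt? ℓ) T
        ≡⟨ cong₂ (λ xs ys → xs ++ t ∷ ys) (Listₚ.filter-none (evenAt? ℓ) (All.map not-¬ T-odd))
                                          (Listₚ.filter-all (oddAt? ℓ) T-odd) ⟩
      t ∷ T ∎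
      where
      open ≡-Reasoning
      T-odd : All (λ s → isEven (shiftDown ℓ s) ≡ false) T
      T-odd = All.zipWith (λ (s∈ , t<s) → odd-upward t∈ s∈ t<s odd) (T∈ , head<tail T-set)

  parts-++ : leftPart S ++ rightPart S ≡ S
  parts-++ = filter-parts S-set (All.tabulate λ s∈ → s∈)

  length-leftPart : ∀ {z} → rightPart S ≡ z ∷ [] → length S ≡ suc (length (leftPart S))
  length-leftPart {z} R≡ = begin
    length S                            ≡⟨ cong length parts-++ ⟨
    length (leftPart S ++ rightPart S)  ≡⟨ cong (λ R → length (leftPart S ++ R)) R≡ ⟩
    length (leftPart S ++ z ∷ [])       ≡⟨ length-∷ʳ (leftPart S) z ⟩
    suc (length (leftPart S))           ∎
    where open ≡-Reasoning

  length-rightPart : ∀ {z} → leftPart S ≡ z ∷ [] → length S ≡ suc (length (rightPart S))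
  length-rightPart L≡ = trans (sym (cong length parts-++)) (cong (λ L → length (L ++ rightPart S)) L≡)

  ++-⊆ : ∀ {e₁ e₂} → e₁ ⊆ leftPart S → e₂ ⊆ rightPart S → e₁ ++ e₂ ⊆ S
  ++-⊆ {e₁} {e₂} e₁⊆ e₂⊆ = subst (e₁ ++ e₂ ⊆_) parts-++ (Sublistₚ.++⁺ e₁⊆ e₂⊆)

  module _ {e₁ e₂ x y} (e₁⊆ : e₁ ⊆ leftPart S) (e₂⊆ : e₂ ⊆ rightPart S) (x∈ : x ∈ e₁) (y∈ : y ∈ e₂) where

    level-++ : level (e₁ ++ e₂) ≡ ℓ
    level-++ = level-unique
      (split (Anyₚ.++⁺ˡ x∈) (Anyₚ.++⁺ʳ e₁ y∈)
             (left≢right (Sublistₚ.Any-resp-⊆ e₁⊆ x∈) (Sublistₚ.Any-resp-⊆ e₂⊆ y∈)))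
      (Sublistₚ.All-resp-⊆ (++-⊆ e₁⊆ e₂⊆) S-block)

    private
      e₁-even : All (λ s → isEven (shiftDown ℓ s) ≡ true) e₁
      e₁-even = Sublistₚ.All-resp-⊆ e₁⊆ leftPart-even

      e₂-odd : All (λ s → isEven (shiftDown ℓ s) ≡ false) e₂
      e₂-odd = Sublistₚ.All-resp-⊆ e₂⊆ rightPart-odd

    leftPart-++ : leftPart (e₁ ++ e₂) ≡ e₁
    leftPart-++ = begin
      leftPart (e₁ ++ e₂)                             ≡⟨ cong (λ l → filter (evenAt? l) (e₁ ++ e₂)) level-++ ⟩
      filter (evenAt? ℓ) (e₁ ++ e₂)                   ≡⟨ Listₚ.filter-++ (evenAt? ℓ) e₁ e₂ ⟩
      filter (evenAt? ℓ) e₁ ++ filter (evenAt? ℓ) e₂  ≡⟨ cong₂ _++_ (Listₚ.filter-all (evenAt? ℓ) e₁-even)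
                                                             (Listₚ.filter-none (evenAt? ℓ) (All.map not-¬ e₂-odd)) ⟩
      e₁ ++ []                                        ≡⟨ Listₚ.++-identityʳ e₁ ⟩
      e₁                                              ∎
      where open ≡-Reasoning

    rightPart-++ : rightPart (e₁ ++ e₂) ≡ e₂
    rightPart-++ = begin
      rightPart (e₁ ++ e₂)                          ≡⟨ cong (λ l → filter (oddAt? l) (e₁ ++ e₂)) level-++ ⟩
      filter (oddAt? ℓ) (e₁ ++ e₂)                  ≡⟨ Listₚ.filter-++ (oddAt? ℓ) e₁ e₂ ⟩
      filter (oddAt? ℓ) e₁ ++ filter (oddAt? ℓ) e₂  ≡⟨ cong₂ _++_ (Listₚ.filter-none (oddAt? ℓ) (All.map not-¬ e₁-even))
                                                           (Listₚ.filter-all (oddAt? ℓ) e₂-odd) ⟩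
      e₂                                            ∎
      where open ≡-Reasoning

-- Monotone binary structures

b-increasing-step : ∀ {S z} → IsSet S → 2 ≤ length S → rightPart S ≡ z ∷ [] →
                    b S ≡ node (length S) (b (leftPart S)) (leaf 1)
b-increasing-step {_ ∷ []} _ (s≤s ()) _
b-increasing-step {x ∷ y ∷ r} S-set S-two R≡ = cong₂ (node _)
  (cong (λ f → bFuel f (leftPart (x ∷ y ∷ r))) (suc-injective (TopSplit.length-leftPart S-set S-two R≡)))
  (cong (bFuel _) R≡)

LInc-step : ∀ {S z} → IsSet S → 2 ≤ length S → rightPart S ≡ z ∷ [] →
            LInc S ≡ LInc (leftPart S) ++ level S ∷ []
LInc-step {_ ∷ []} _ (s≤s ()) _
LInc-step {x ∷ y ∷ r} S-set S-two R≡ =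
  cong (λ f → LIncFuel f (leftPart (x ∷ y ∷ r)) ++ level (x ∷ y ∷ r) ∷ [])
       (suc-injective (TopSplit.length-leftPart S-set S-two R≡))

b-decreasing-step : ∀ {S z} → IsSet S → 2 ≤ length S → leftPart S ≡ z ∷ [] →
                    b S ≡ node (length S) (leaf 1) (b (rightPart S))
b-decreasing-step {_ ∷ []} _ (s≤s ()) _
b-decreasing-step {x ∷ y ∷ r} S-set S-two L≡ = cong₂ (node _)
  (cong (bFuel _) L≡)
  (cong (λ f → bFuel f (rightPart (x ∷ y ∷ r))) (suc-injective (TopSplit.length-rightPart S-set S-two L≡)))

LDec-step : ∀ {S z} → IsSet S → 2 ≤ length S → leftPart S ≡ z ∷ [] →
            LDec S ≡ LDec (rightPart S) ++ level S ∷ []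
LDec-step {_ ∷ []} _ (s≤s ()) _
LDec-step {x ∷ y ∷ r} S-set S-two L≡ =
  cong (λ f → LDecFuel f (rightPart (x ∷ y ∷ r)) ++ level (x ∷ y ∷ r) ∷ [])
       (suc-injective (TopSplit.length-rightPart S-set S-two L≡))

bFuel-leaf : ∀ {f R a w} → a ∈ R → bFuel (suc f) R ≡ leaf w → R ≡ a ∷ []
bFuel-leaf {R = _ ∷ []} (here refl) _ = refl
bFuel-leaf {R = _ ∷ []} (there ()) _
bFuel-leaf {R = _ ∷ _ ∷ _} _ ()

Increasing-right-leaf : ∀ {w l r} → Increasing (node w l r) → ∃ λ w′ → r ≡ leaf w′
Increasing-right-leaf (node _) = _ , refl

Decreasing-left-leaf : ∀ {w l r} → Decreasing (node w l r) → ∃ λ w′ → l ≡ leaf w′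
Decreasing-left-leaf (node _) = _ , refl

-- Along these views the fuel of b, LInc and LDec always equals the size of the set, so the
-- paper's recursions b S = node (b Left) (leaf 1) and L(S) = L(Left) ++ [ℓ(S)] hold at
-- every step (the *-step lemmas); all inductions below follow the views.
data IncreasingView : List ℕ → Set where
  [_]  : ∀ s → IncreasingView (s ∷ [])
  grow : ∀ {S z} → IsSet S → 2 ≤ length S → rightPart S ≡ z ∷ [] →
         IncreasingView (leftPart S) → IncreasingView S

data DecreasingView : List ℕ → Set where
  [_]  : ∀ s → DecreasingView (s ∷ [])
  grow : ∀ {S z} → IsSet S → 2 ≤ length S → leftPart S ≡ z ∷ [] →
         DecreasingView (rightPart S) → DecreasingView S

increasing-view : ∀ n {S} → length S ≡ suc n → IsSet S → Increasing (b S) → IncreasingView S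
increasing-view n {[]} () _ _
increasing-view zero {s ∷ []} _ _ _ = [ s ]
increasing-view (suc n) {_ ∷ []} () _ _
increasing-view zero {_ ∷ _ ∷ _} () _ _
increasing-view (suc n) {S@(_ ∷ _ ∷ _)} len S-set inc =
  grow S-set S-two R≡ (increasing-view n len-L (IsSet-⊆ leftPart-⊆ S-set) inc-L)
  where
  S-two : 2 ≤ length S
  S-two = s≤s (s≤s z≤n)
  open TopSplit S-set S-two
  z : ℕ
  z = proj₁ (proj₂ parts-nonempty)
  R≡ : rightPart S ≡ z ∷ []
  R≡ = bFuel-leaf (proj₂ (proj₂ parts-nonempty)) (proj₂ (Increasing-right-leaf inc))
  len-L : length (leftPart S) ≡ suc n
  len-L = suc-injective (trans (sym (length-leftPart R≡)) len)
  inc-L : Increasing (b (leftPart S))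
  inc-L with subst Increasing (b-increasing-step S-set S-two R≡) inc
  ... | node i = i

decreasing-view : ∀ n {S} → length S ≡ suc n → IsSet S → Decreasing (b S) → DecreasingView S
decreasing-view n {[]} () _ _
decreasing-view zero {s ∷ []} _ _ _ = [ s ]
decreasing-view (suc n) {_ ∷ []} () _ _
decreasing-view zero {_ ∷ _ ∷ _} () _ _
decreasing-view (suc n) {S@(_ ∷ _ ∷ _)} len S-set dec =
  grow S-set S-two L≡ (decreasing-view n len-R (IsSet-⊆ rightPart-⊆ S-set) dec-R)
  where
  S-two : 2 ≤ length S
  S-two = s≤s (s≤s z≤n)
  open TopSplit S-set S-two
  z : ℕ
  z = proj₁ (proj₁ parts-nonempty)
  L≡ : leftPart S ≡ z ∷ []
  L≡ = bFuel-leaf (proj₂ (proj₁ parts-nonempty)) (proj₂ (Decreasing-left-leaf dec))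
  len-R : length (rightPart S) ≡ suc n
  len-R = suc-injective (trans (sym (length-rightPart L≡)) len)
  dec-R : Decreasing (b (rightPart S))
  dec-R with subst Decreasing (b-decreasing-step S-set S-two L≡) dec
  ... | node d = d

LInc-length : ∀ {S} → IncreasingView S → suc (length (LInc S)) ≡ length S
LInc-length [ s ] = refl
LInc-length (grow {S} S-set S-two R≡ v) = begin
  suc (length (LInc S))                             ≡⟨ cong (suc ∘ length) (LInc-step S-set S-two R≡) ⟩
  suc (length (LInc (leftPart S) ++ level S ∷ []))  ≡⟨ cong suc (length-∷ʳ (LInc (leftPart S)) (level S)) ⟩
  suc (suc (length (LInc (leftPart S))))            ≡⟨ cong suc (LInc-length v) ⟩
  suc (length (leftPart S))                         ≡⟨ TopSplit.length-leftPart S-set S-two R≡ ⟨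
  length S                                          ∎
  where open ≡-Reasoning

LDec-length : ∀ {S} → DecreasingView S → suc (length (LDec S)) ≡ length S
LDec-length [ s ] = refl
LDec-length (grow {S} S-set S-two L≡ v) = begin
  suc (length (LDec S))                              ≡⟨ cong (suc ∘ length) (LDec-step S-set S-two L≡) ⟩
  suc (length (LDec (rightPart S) ++ level S ∷ []))  ≡⟨ cong suc (length-∷ʳ (LDec (rightPart S)) (level S)) ⟩
  suc (suc (length (LDec (rightPart S))))            ≡⟨ cong suc (LDec-length v) ⟩
  suc (length (rightPart S))                         ≡⟨ TopSplit.length-rightPart S-set S-two L≡ ⟨
  length S                                           ∎
  where open ≡-Reasoning

LInc-<-block : ∀ {S m d} → IncreasingView S → Block m d S → All (_< m) (LInc S)
LInc-<-block [ s ] _ = []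
LInc-<-block (grow S-set S-two R≡ v) blk rewrite LInc-step S-set S-two R≡ =
  Allₚ.++⁺ (LInc-<-block v (Sublistₚ.All-resp-⊆ (TopSplit.leftPart-⊆ S-set S-two) blk))
           (level-<-block (set-split S-set S-two) blk ∷ [])

LDec-<-block : ∀ {S m d} → DecreasingView S → Block m d S → All (_< m) (LDec S)
LDec-<-block [ s ] _ = []
LDec-<-block (grow S-set S-two L≡ v) blk rewrite LDec-step S-set S-two L≡ =
  Allₚ.++⁺ (LDec-<-block v (Sublistₚ.All-resp-⊆ (TopSplit.rightPart-⊆ S-set S-two) blk))
           (level-<-block (set-split S-set S-two) blk ∷ [])

LInc-isSet : ∀ {S} → IncreasingView S → IsSet (LInc S)
LInc-isSet [ s ] = []
LInc-isSet (grow S-set S-two R≡ v) rewrite LInc-step S-set S-two R≡ =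
  IsSet-∷ʳ (LInc-isSet v) (LInc-<-block v (TopSplit.leftPart-block S-set S-two))

LDec-isSet : ∀ {S} → DecreasingView S → IsSet (LDec S)
LDec-isSet [ s ] = []
LDec-isSet (grow S-set S-two L≡ v) rewrite LDec-step S-set S-two L≡ =
  IsSet-∷ʳ (LDec-isSet v) (LDec-<-block v (TopSplit.rightPart-block S-set S-two))

record Realisation (Shape : Tree → Set) (L : List ℕ → List ℕ) (S D : List ℕ) : Set where
  field
    edge        : List ℕ
    edge-⊆      : edge ⊆ S
    edge-length : length edge ≡ suc (length D)
    edge-shape  : Shape (b edge)
    edge-L      : L edge ≡ D

realisation-⊆ : ∀ {Shape L S S′ D} → S ⊆ S′ → Realisation Shape L S D → Realisation Shape L S′ D
realisation-⊆ S⊆S′ r = record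
  { edge = edge ; edge-⊆ = ⊆-trans edge-⊆ S⊆S′
  ; edge-length = edge-length ; edge-shape = edge-shape ; edge-L = edge-L }
  where open Realisation r

extend-increasing : ∀ {S z D} → IsSet S → 2 ≤ length S → z ∈ rightPart S →
                    Realisation Increasing LInc (leftPart S) D →
                    Realisation Increasing LInc S (D ++ level S ∷ [])
extend-increasing {S} {z} {D} S-set S-two z∈R
  record { edge = e@(_ ∷ _) ; edge-⊆ = e⊆L ; edge-length = e-length ; edge-shape = e-inc ; edge-L = e-LInc } = record
  { edge        = e ++ z ∷ []
  ; edge-⊆      = ez⊆S
  ; edge-length = trans (length-∷ʳ e z) (cong suc (trans e-length (sym (length-∷ʳ D (level S)))))
  ; edge-shape  = subst Increasing (sym (b-increasing-step ez-set ez-two R≡))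
                        (node (subst (Increasing ∘ b) (sym L≡) e-inc))
  ; edge-L      = trans (LInc-step ez-set ez-two R≡)
                        (cong₂ (λ L ℓ → L ++ ℓ ∷ []) (trans (cong LInc L≡) e-LInc) level≡)
  }
  where
  open TopSplit S-set S-two
  z⊆R : z ∷ [] ⊆ rightPart S
  z⊆R = from∈ z∈R
  level≡ : level (e ++ z ∷ []) ≡ level S
  level≡ = level-++ e⊆L z⊆R (here refl) (here refl)
  L≡ : leftPart (e ++ z ∷ []) ≡ e
  L≡ = leftPart-++ e⊆L z⊆R (here refl) (here refl)
  R≡ : rightPart (e ++ z ∷ []) ≡ z ∷ []
  R≡ = rightPart-++ e⊆L z⊆R (here refl) (here refl)
  ez⊆S : e ++ z ∷ [] ⊆ S
  ez⊆S = ++-⊆ e⊆L z⊆R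
  ez-set : IsSet (e ++ z ∷ [])
  ez-set = IsSet-⊆ ez⊆S S-set
  ez-two : 2 ≤ length (e ++ z ∷ [])
  ez-two = subst (2 ≤_) (sym (length-∷ʳ e z)) (s≤s (s≤s z≤n))

extend-decreasing : ∀ {S z D} → IsSet S → 2 ≤ length S → z ∈ leftPart S →
                    Realisation Decreasing LDec (rightPart S) D →
                    Realisation Decreasing LDec S (D ++ level S ∷ [])
extend-decreasing {S} {z} {D} S-set S-two z∈L
  record { edge = e@(_ ∷ _) ; edge-⊆ = e⊆R ; edge-length = e-length ; edge-shape = e-dec ; edge-L = e-LDec } = record
  { edge        = z ∷ e
  ; edge-⊆      = ze⊆S
  ; edge-length = cong suc (trans e-length (sym (length-∷ʳ D (level S))))
  ; edge-shape  = subst Decreasing (sym (b-decreasing-step ze-set ze-two L≡))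
                        (node (subst (Decreasing ∘ b) (sym R≡) e-dec))
  ; edge-L      = trans (LDec-step ze-set ze-two L≡)
                        (cong₂ (λ L ℓ → L ++ ℓ ∷ []) (trans (cong LDec R≡) e-LDec) level≡)
  }
  where
  open TopSplit S-set S-two
  z⊆L : z ∷ [] ⊆ leftPart S
  z⊆L = from∈ z∈L
  level≡ : level (z ∷ e) ≡ level S
  level≡ = level-++ z⊆L e⊆R (here refl) (here refl)
  L≡ : leftPart (z ∷ e) ≡ z ∷ []
  L≡ = leftPart-++ z⊆L e⊆R (here refl) (here refl)
  R≡ : rightPart (z ∷ e) ≡ e
  R≡ = rightPart-++ z⊆L e⊆R (here refl) (here refl)
  ze⊆S : z ∷ e ⊆ S
  ze⊆S = ++-⊆ z⊆L e⊆R
  ze-set : IsSet (z ∷ e)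
  ze-set = IsSet-⊆ ze⊆S S-set
  ze-two : 2 ≤ length (z ∷ e)
  ze-two = s≤s (s≤s z≤n)

LInc-realise : ∀ {S D} → IncreasingView S → D ⊆ LInc S → Realisation Increasing LInc S D
LInc-realise [ s ] [] = record
  { edge = s ∷ [] ; edge-⊆ = ⊆-refl ; edge-length = refl ; edge-shape = leaf ; edge-L = refl }
LInc-realise (grow {z = z} S-set S-two R≡ v) D⊆ with ⊆-∷ʳ⁻ (subst (_ ⊆_) (LInc-step S-set S-two R≡) D⊆)
... | inj₁ D⊆L = realisation-⊆ (TopSplit.leftPart-⊆ S-set S-two) (LInc-realise v D⊆L)
... | inj₂ (D′ , refl , D′⊆L) =
  extend-increasing S-set S-two (subst (z ∈_) (sym R≡) (here refl)) (LInc-realise v D′⊆L)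

LDec-realise : ∀ {S D} → DecreasingView S → D ⊆ LDec S → Realisation Decreasing LDec S D
LDec-realise [ s ] [] = record
  { edge = s ∷ [] ; edge-⊆ = ⊆-refl ; edge-length = refl ; edge-shape = leaf ; edge-L = refl }
LDec-realise (grow {z = z} S-set S-two L≡ v) D⊆ with ⊆-∷ʳ⁻ (subst (_ ⊆_) (LDec-step S-set S-two L≡) D⊆)
... | inj₁ D⊆R = realisation-⊆ (TopSplit.rightPart-⊆ S-set S-two) (LDec-realise v D⊆R)
... | inj₂ (D′ , refl , D′⊆R) =
  extend-decreasing S-set S-two (subst (z ∈_) (sym L≡) (here refl)) (LDec-realise v D′⊆R)

mirror : ℕ → ℕ → ℕ
mirror N ℓ = N ∸ 1 ∸ ℓ

mirror-< : ∀ N {ℓ} → ℓ < N → mirror N ℓ < N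
mirror-< (suc n) {ℓ} _ = s≤s (m∸n≤m n ℓ)

mirror-antitone : ∀ N {ℓ ℓ′} → ℓ < ℓ′ → ℓ′ < N → mirror N ℓ′ < mirror N ℓ
mirror-antitone N ℓ<ℓ′ ℓ′<N = ∸-monoʳ-< ℓ<ℓ′ (∸-monoˡ-≤ 1 ℓ′<N)

mirrored-isSet : ∀ N {L} → IsSet L → All (_< N) L → IsSet (reverse (map (mirror N) L))
mirrored-isSet N {[]} _ _ = []
mirrored-isSet N {x ∷ xs} L-set (_ ∷ xs<N) =
  subst IsSet (sym (Listₚ.unfold-reverse (mirror N x) (map (mirror N) xs)))
    (IsSet-∷ʳ (mirrored-isSet N (Linked.tail L-set) xs<N)
              (All-reverse (Allₚ.map⁺ (All.zipWith (λ (x<y , y<N) → mirror-antitone N x<y y<N)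
                                                    (head<tail L-set , xs<N)))))

mirrored-< : ∀ N {L} → All (_< N) L → All (_< N) (reverse (map (mirror N) L))
mirrored-< N L<N = All-reverse (Allₚ.map⁺ (All.map (mirror-< N) L<N))

⊆-mirrored⁻ : ∀ N L {D} → D ⊆ reverse (map (mirror N) L) →
              ∃ λ D₀ → D₀ ⊆ L × map (mirror N) D₀ ≡ reverse D
⊆-mirrored⁻ N L D⊆ = ⊆-map⁻ (mirror N) L
  (subst (_ ⊆_) (Listₚ.reverse-involutive (map (mirror N) L)) (Sublistₚ.reverse⁺ D⊆))

-- Independent sets of the stepping-up

Prune-weight : ∀ {t T} → Prune t T → weight T ≡ weight t
Prune-weight stop = refl
Prune-weight (node _ _) = refl

b-weight : ∀ S → weight (b S) ≡ length S
b-weight [] = refl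
b-weight (_ ∷ []) = refl
b-weight (_ ∷ _ ∷ _) = refl

module SteppingUpIndependent {N k : ℕ} {G1 G2 : List ℕ → Set} {𝒯 : Tree → Set} {I : List ℕ}
                             (I-indep : Independent (2 ^ N) (SteppingUp N (suc k) G1 G2 𝒯) I) where

  I-set : IsSet I
  I-set = proj₁ I-indep

  private
    I-bounded : All (_< 2 ^ N) I
    I-bounded = proj₁ (proj₂ I-indep)

    no-edge : ∀ {e} → e ⊆ I → ¬ SteppingUp N (suc k) G1 G2 𝒯 e
    no-edge {e} = proj₂ (proj₂ I-indep) e

    I-block : ∀ {S} → S ⊆ I → Block N 0 S
    I-block S⊆I = All.map (shiftDown-small N) (Sublistₚ.All-resp-⊆ S⊆I I-bounded)

  LInc-independent : Uniform N k G1 → ∀ {S} → S ⊆ I → IncreasingView S → Independent N G1 (LInc S)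
  LInc-independent G1-uniform {S} S⊆I v = LInc-isSet v , LInc-<-block v (I-block S⊆I) , no-G1-edge
    where
    no-G1-edge : ∀ D → D ⊆ LInc S → ¬ G1 D
    no-G1-edge D D⊆ D∈G1 = no-edge e⊆I
      ( IsSet-⊆ e⊆I I-set , Sublistₚ.All-resp-⊆ e⊆I I-bounded
      , trans edge-length (cong suc (proj₁ (proj₂ (G1-uniform D D∈G1))))
      , inj₁ (edge-shape , D , D∈G1 , ↭⇒SameSet (↭-reflexive (sym edge-L))) )
      where
      open Realisation (LInc-realise v D⊆)
      e⊆I : edge ⊆ I
      e⊆I = ⊆-trans edge-⊆ S⊆I

  mirrored-LDec-independent : Uniform N k G2 → ∀ {S} → S ⊆ I → DecreasingView S →
                              Independent N G2 (reverse (map (mirror N) (LDec S)))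
  mirrored-LDec-independent G2-uniform {S} S⊆I v =
    mirrored-isSet N (LDec-isSet v) LDec<N , mirrored-< N LDec<N , no-G2-edge
    where
    LDec<N : All (_< N) (LDec S)
    LDec<N = LDec-<-block v (I-block S⊆I)

    no-G2-edge : ∀ D → D ⊆ reverse (map (mirror N) (LDec S)) → ¬ G2 D
    no-G2-edge D D⊆ D∈G2 with ⊆-mirrored⁻ N (LDec S) D⊆
    ... | D₀ , D₀⊆ , D₀≡ = no-edge e⊆I
      ( IsSet-⊆ e⊆I I-set , Sublistₚ.All-resp-⊆ e⊆I I-bounded
      , trans edge-length (cong suc (trans |D₀|≡|D| (proj₁ (proj₂ (G2-uniform D D∈G2)))))
      , inj₂ (inj₁ (edge-shape , D , D∈G2 , ↭⇒SameSet D↭mirrored)) )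
      where
      open Realisation (LDec-realise v D₀⊆)
      e⊆I : edge ⊆ I
      e⊆I = ⊆-trans edge-⊆ S⊆I
      |D₀|≡|D| : length D₀ ≡ length D
      |D₀|≡|D| = trans (sym (Listₚ.length-map (mirror N) D₀)) (trans (cong length D₀≡) (Listₚ.length-reverse D))
      D↭mirrored : D ↭ map (mirror N) (LDec edge)
      D↭mirrored = ↭-trans (↭-sym (↭-reverse D)) (↭-reflexive (sym (trans (cong (map (mirror N)) edge-L) D₀≡)))

  no-typed-subset : (∀ T → 𝒯 T → IsType T × weight T ≡ suc k) → ∀ S → S ⊆ I → ∀ T → 𝒯 T → ¬ OfType S T
  no-typed-subset 𝒯-sized S S⊆I T T∈𝒯 S∶T = no-edge S⊆I
    ( IsSet-⊆ S⊆I I-set , Sublistₚ.All-resp-⊆ S⊆I I-bounded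
    , trans (sym (b-weight S)) (trans (sym (Prune-weight S∶T)) (proj₂ (𝒯-sized T T∈𝒯)))
    , inj₂ (inj₂ (T , T∈𝒯 , S∶T)) )

exceeds-max : ∀ {P a X} → IsMax P a → P X → length X ≡ suc a → ⊥
exceeds-max {a = a} (_ , maximal) PX len = 1+n≰n (subst (_≤ a) len (maximal _ PX))

independent⇒avoids : ∀ {N k G1 G2 𝒯 a1 a2 I} → Uniform N k G1 → Uniform N k G2 →
  (∀ T → 𝒯 T → IsType T × weight T ≡ suc k) →
  IsMax (Independent N G1) a1 → IsMax (Independent N G2) a2 →
  Independent (2 ^ N) (SteppingUp N (suc k) G1 G2 𝒯) I → Avoids (a1 + 2) (a2 + 2) 𝒯 I
independent⇒avoids {N = N} {a1 = a1} {a2 = a2} {I = I} G1-uniform G2-uniform 𝒯-sized a1-max a2-max I-indep =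
  I-set , no-increasing , no-decreasing , no-typed-subset 𝒯-sized
  where
  open SteppingUpIndependent {N = N} I-indep

  +2-suc : ∀ {n a} → n ≡ a + 2 → n ≡ suc (suc a)
  +2-suc {a = a} eq = trans eq (+-comm a 2)

  no-increasing : ∀ S → S ⊆ I → length S ≡ a1 + 2 → ¬ Increasing (b S)
  no-increasing S S⊆I len inc = exceeds-max a1-max (LInc-independent G1-uniform S⊆I v)
    (suc-injective (trans (LInc-length v) (+2-suc len)))
    where
    v : IncreasingView S
    v = increasing-view (suc a1) (+2-suc len) (IsSet-⊆ S⊆I I-set) inc

  no-decreasing : ∀ S → S ⊆ I → length S ≡ a2 + 2 → ¬ Decreasing (b S)
  no-decreasing S S⊆I len dec = exceeds-max a2-max (mirrored-LDec-independent G2-uniform S⊆I v)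
    (suc-injective (trans (cong suc |mirrored|≡) (trans (LDec-length v) (+2-suc len))))
    where
    v : DecreasingView S
    v = decreasing-view (suc a2) (+2-suc len) (IsSet-⊆ S⊆I I-set) dec
    |mirrored|≡ : length (reverse (map (mirror N) (LDec S))) ≡ length (LDec S)
    |mirrored|≡ = trans (Listₚ.length-reverse (map (mirror N) (LDec S))) (Listₚ.length-map (mirror N) (LDec S))

lemma2p8 : (N k : ℕ) → 1 ≤ k →
    (G1 G2 : List ℕ → Set) → Uniform N (k ∸ 1) G1 → Uniform N (k ∸ 1) G2 →
    (𝒯 : Tree → Set) → (∀ T → 𝒯 T → IsType T × weight T ≡ k) →
    (a1 a2 a m : ℕ) →
    IsMax (Independent N G1) a1 →
    IsMax (Independent N G2) a2 →
    IsMax (Independent (2 ^ N) (SteppingUp N k G1 G2 𝒯)) a →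
    IsMax (Avoids (a1 + 2) (a2 + 2) 𝒯) m →
    a ≤ m
lemma2p8 N (suc k) _ G1 G2 G1-uniform G2-uniform 𝒯 𝒯-sized a1 a2 a m a1-max a2-max
         ((I , I-indep , |I|≡a) , _) (_ , m-max) =
  subst (_≤ m) |I|≡a (m-max I (independent⇒avoids G1-uniform G2-uniform 𝒯-sized a1-max a2-max I-indep))
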